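{- Let $n$ and $d_0$ be integers with $2\le d_0\le n-3$, and let $G=G(1,1;d_0,n-d_0-2)$ be the double nested graph with $h=2$, $m_1=m_2=1$, $n_1=d_0$, $n_2=n-d_0-2$ (a quasi-tree graph on $n$ vertices). Then the number of spanning trees of $G$ is $\tau(G)=2^{d_0-1}d_0$.
   Context: A bipartite graph $G$ with bipartition $(U,V)$ is a double nested graph if there are partitions $U=U_1\cup\cdots\cup U_h$ and $V=V_1\cup\cdots\cup V_h$ into non-empty sets such that, for each $1\le i\le h$, the neighborhood of every vertex of $U_i$ is exactly $V_1\cup V_2\cup\cdots\cup V_{h+1-i}$. If $|U_i|=m_i$ and $|V_i|=n_i$, the graph is denoted $G(m_1,\dots,m_h;n_1,\dots,n_h)$. A connected graph is a quasi-tree if deleting some vertex leaves a tree. $\tau(G)$ denotes the number of spanning trees of $G$. -}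

module Defs where

open import Data.Nat using (ℕ; zero; suc; _+_; _∸_; _<ᵇ_; _≤_)
open import Data.Bool using (Bool; true; false; _∧_; _∨_; if_then_else_)
open import Data.List using (List; []; _∷_; length)
open import Data.Nat.ListAction using (sum)
open import Data.Fin using (Fin; zero; suc; toℕ; inject₁; fromℕ)
open import Data.Product using (Σ; _×_; ∃)
open import Relation.Binary.PropositionalEquality using (_≡_)
open import Relation.Nullary using (¬_)

-- Finite simple graphs on the vertex set Fin N, given by a Boolean
-- adjacency function (assumed symmetric and loopless for the graphs we
-- construct).

record Graph : Set where
  field
    N   : ℕ
    adj : Fin N → Fin N → Bool

open Graph public

EdgeSet : ℕ → Set
EdgeSet N = Fin N → Fin N → Bool

data Walk {N : ℕ} (T : EdgeSet N) : Fin N → Fin N → Set where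
  here : ∀ {u} → Walk T u u
  step : ∀ {u v w} → T u v ≡ true → Walk T v w → Walk T u w

Connected : {N : ℕ} → EdgeSet N → Set
Connected {N} T = (u v : Fin N) → Walk T u v

record Cycle {N : ℕ} (T : EdgeSet N) : Set where
  field
    k       : ℕ
    c       : Fin (suc (suc (suc k))) → Fin N
    inj     : ∀ i j → c i ≡ c j → i ≡ j
    consec  : (i : Fin (suc (suc k))) → T (c (inject₁ i)) (c (suc i)) ≡ true
    closing : T (c (fromℕ (suc (suc k)))) (c zero) ≡ true

Acyclic : {N : ℕ} → EdgeSet N → Set
Acyclic T = ¬ Cycle T

record IsSpanningTree (G : Graph) (T : EdgeSet (N G)) : Set where
  field
    subgraph  : ∀ i j → T i j ≡ true → adj G i j ≡ true
    symmetric : ∀ i j → T i j ≡ T j i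
    connected : Connected T
    acyclic   : Acyclic T

_≐_ : {N : ℕ} → EdgeSet N → EdgeSet N → Set
_≐_ {N} S T = (i j : Fin N) → S i j ≡ T i j

-- τ(G) = k : the spanning trees of G are enumerated, without repetition,
-- by Fin k.
NumSpanningTrees : Graph → ℕ → Set
NumSpanningTrees G k =
  Σ (Fin k → EdgeSet (N G)) λ trees →
    ((i : Fin k) → IsSpanningTree G (trees i))
  × ((i j : Fin k) → trees i ≐ trees j → i ≡ j)
  × ((T : EdgeSet (N G)) → IsSpanningTree G T → ∃ λ i → T ≐ trees i)

-- Double nested graphs G(m_1,…,m_h ; n_1,…,n_h), h = length ms = length ns.
-- Vertices are Fin (m_1+…+m_h + n_1+…+n_h): first the blocks U_1,…,U_h
-- (in order), then the blocks V_1,…,V_h (in order).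

-- 0-based index of the block containing position x, for block sizes as.
blockOf : List ℕ → ℕ → ℕ
blockOf []       x = 0
blockOf (a ∷ as) x = if x <ᵇ a then 0 else suc (blockOf as (x ∸ a))

-- x ∈ U_{i+1}, y ∈ V_{j+1} (0-based i, j) are adjacent iff
-- j+1 ≤ h+1-(i+1), i.e. i + j < h.
dnUV : (ms ns : List ℕ) → ℕ → ℕ → Bool
dnUV ms ns x y =
  (x <ᵇ sum ms) ∧ (if y <ᵇ sum ms then false
                   else ((y ∸ sum ms) <ᵇ sum ns)
                        ∧ ((blockOf ms x + blockOf ns (y ∸ sum ms)) <ᵇ length ms))

DoubleNested : (ms ns : List ℕ) → Graph
DoubleNested ms ns = record
  { N   = sum ms + sum ns
  ; adj = λ x y → dnUV ms ns (toℕ x) (toℕ y) ∨ dnUV ms ns (toℕ y) (toℕ x)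
  }

-- Write a, b for the vertices of U₁, U₂. Every vertex of V₂ is a leaf at a, and every
-- vertex of V₁ is adjacent to exactly a and b. So a spanning tree contains all the pendant
-- edges, joins each vertex of V₁ to a or to b, and joins exactly one of them, the hub, to
-- both: at least one because a and b are connected, at most one because two hubs close the
-- 4-cycle a w b w′. Conversely every such choice is a spanning tree: it connects everything
-- through a, and it is bipartite with a single vertex of degree ≥ 2 on the V side, hence
-- acyclic. There are d₀ choices of the hub and 2^(d₀-1) of the attachments of the rest.

module Submission where

open import Defs
open import Data.Nat using (ℕ; zero; suc; _+_; _*_; _∸_; _^_; _≤_; _<_; s≤s; _<ᵇ_)
open import Data.List using ([]; _∷_)
open import Data.Nat.Properties using (m+n∸m≡n; +-identityʳ; <⇒<ᵇ)
open import Data.Fin using (Fin; zero; suc; toℕ; splitAt; join; _↑ˡ_; _↑ʳ_; punchIn; punchOut; fromℕ; combine; finToFun; funToFin; _≟_)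
open import Data.Fin.Properties using (toℕ-↑ˡ; toℕ-↑ʳ; toℕ<n; splitAt-↑ˡ; splitAt-↑ʳ; join-splitAt; punchOut-cong′; punchOut-punchIn; punchIn-punchOut; punchInᵢ≢i; funToFin-finToFin; finToFun-funToFin; *↔×)
open import Data.Bool using (Bool; true; false; not; _∨_; _∧_)
open import Data.Bool.Properties using (∨-comm; ∨-identityʳ; ¬-not; T-≡)
open import Data.Sum using (_⊎_; inj₁; inj₂; [_,_]′)
open import Data.Product using (_×_; _,_; proj₁; proj₂; ∃; ∃₂)
open import Data.Empty using (⊥; ⊥-elim)
open import Function using (_∘_; _↔_; Inverse; Equivalence)
open import Relation.Nullary using (yes; no)
open import Relation.Binary.PropositionalEquality

<⇒<ᵇ≡true : ∀ {i n} → i < n → (i <ᵇ n) ≡ true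
<⇒<ᵇ≡true = Equivalence.to T-≡ ∘ <⇒<ᵇ

m+n<ᵇm≡false : ∀ m n → (m + n <ᵇ m) ≡ false
m+n<ᵇm≡false zero    n = refl
m+n<ᵇm≡false (suc m) n = m+n<ᵇm≡false m n

≢-≢⇒≡ : {x y z : Bool} → x ≢ y → y ≢ z → x ≡ z
≢-≢⇒≡ x≢y y≢z = trans (¬-not x≢y) (sym (¬-not (y≢z ∘ sym)))

true≢false : true ≢ false
true≢false ()

∨≡true : ∀ {x y} → x ∨ y ≡ true → x ≡ true ⊎ y ≡ true
∨≡true {true}  _   = inj₁ refl
∨≡true {false} y≡t = inj₂ y≡t

∨-mono-≡true : ∀ {x y x′ y′} → (x ≡ true → x′ ≡ true) → (y ≡ true → y′ ≡ true) →
               x ∨ y ≡ true → x′ ∨ y′ ≡ true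
∨-mono-≡true {x′ = x′} {y′} f g x∨y with ∨≡true x∨y
... | inj₁ x≡t = cong (_∨ y′) (f x≡t)
... | inj₂ y≡t = trans (∨-comm x′ y′) (cong (_∨ x′) (g y≡t))

funToFin-cong : ∀ {n} {f g : Fin n → Fin 2} → (∀ i → f i ≡ g i) → funToFin f ≡ funToFin g
funToFin-cong {zero}  f≗g = refl
funToFin-cong {suc n} f≗g = cong₂ combine (f≗g zero) (funToFin-cong (f≗g ∘ suc))

module _ {N : ℕ} {T : EdgeSet N} where

  _++ʷ_ : ∀ {u v w} → Walk T u v → Walk T v w → Walk T u w
  here     ++ʷ q = q
  step e p ++ʷ q = step e (p ++ʷ q)

  reverseʷ : (∀ i j → T i j ≡ T j i) → ∀ {u v} → Walk T u v → Walk T v u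
  reverseʷ T-sym here               = here
  reverseʷ T-sym (step {u} {v} e p) = reverseʷ T-sym p ++ʷ step (trans (T-sym v u) e) here

  connected-viaRoot : (∀ i j → T i j ≡ T j i) → (r : Fin N) → (∀ x → Walk T x r) → Connected T
  connected-viaRoot T-sym r toRoot x y = toRoot x ++ʷ reverseʷ T-sym (toRoot y)

  firstStep : ∀ {x y} → Walk T x y → x ≢ y → ∃ λ v → T x v ≡ true
  firstStep here                x≢y = ⊥-elim (x≢y refl)
  firstStep (step {v = v} e _)  _   = v , e

  Branching : Fin N → Set
  Branching v = ∃₂ λ x y → x ≢ y × T v x ≡ true × T v y ≡ true

  -- Every vertex of a cycle branches, and a bipartite cycle has two vertices on each side.
  acyclic-bipartite-singleHub :
    (∀ i j → T i j ≡ T j i) →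
    (side : Fin N → Bool) → (∀ x y → T x y ≡ true → side x ≢ side y) →
    (hub : Fin N) → (∀ v → side v ≡ false → Branching v → v ≡ hub) →
    Acyclic T
  acyclic-bipartite-singleHub T-sym side bipartite hub singleHub
    record { k = zero ; consec = consec ; closing = closing } =
    bipartite _ _ closing (sym (≢-≢⇒≡ (bipartite _ _ (consec zero)) (bipartite _ _ (consec (suc zero)))))
  acyclic-bipartite-singleHub T-sym side bipartite hub singleHub
    record { k = suc k ; c = c ; inj = inj ; consec = consec ; closing = closing } =
    bySide₁ (side (c (suc zero))) refl
    where
      flip : ∀ {i j} → T (c i) (c j) ≡ true → T (c j) (c i) ≡ true
      flip {i} {j} e = trans (T-sym (c j) (c i)) e

      distinct : ∀ {i j} → i ≢ j → c i ≢ c j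
      distinct i≢j cᵢ≡cⱼ = i≢j (inj _ _ cᵢ≡cⱼ)

      last : Fin (suc (suc (suc (suc k))))
      last = fromℕ (suc (suc (suc k)))

      bySide₁ : ∀ s → side (c (suc zero)) ≡ s → ⊥
      bySide₁ false side₁ = distinct {suc zero} {last} (λ ()) (trans c₁≡hub (sym cₗ≡hub))
        where
          c₁≡hub : c (suc zero) ≡ hub
          c₁≡hub = singleHub _ side₁
            (_ , _ , distinct (λ ()) , flip (consec zero) , consec (suc zero))
          cₗ≡hub : c last ≡ hub
          cₗ≡hub = singleHub _
            (trans (≢-≢⇒≡ (bipartite _ _ closing) (bipartite _ _ (consec zero))) side₁)
            (_ , _ , distinct (λ ()) , closing , flip (consec (fromℕ (suc (suc k)))))
      bySide₁ true side₁ = distinct {zero} {suc (suc zero)} (λ ()) (trans c₀≡hub (sym c₂≡hub))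
        where
          side₀ : side (c zero) ≡ false
          side₀ = trans (¬-not (bipartite _ _ (consec zero))) (cong not side₁)
          c₀≡hub : c zero ≡ hub
          c₀≡hub = singleHub _ side₀
            (_ , _ , distinct (λ ()) , consec zero , flip closing)
          c₂≡hub : c (suc (suc zero)) ≡ hub
          c₂≡hub = singleHub _
            (trans (sym (≢-≢⇒≡ (bipartite _ _ (consec zero)) (bipartite _ _ (consec (suc zero))))) side₀)
            (_ , _ , distinct (λ ()) , flip (consec (suc zero)) , consec (suc (suc zero)))

numSpanningTrees-byEnumeration :
  ∀ {G k} {I : Set} → Fin k ↔ I → (tree : I → EdgeSet (N G)) →
  (∀ i → IsSpanningTree G (tree i)) → (∀ i j → tree i ≐ tree j → i ≡ j) →
  (∀ T → IsSpanningTree G T → ∃ λ i → T ≐ tree i) → NumSpanningTrees G k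
numSpanningTrees-byEnumeration {G} enum tree spanning injective complete =
  tree ∘ to , spanning ∘ to , injective′ , complete′
  where
    open Inverse enum

    injective′ : ∀ i j → tree (to i) ≐ tree (to j) → i ≡ j
    injective′ i j eq = trans (sym (strictlyInverseʳ i))
                              (trans (cong from (injective _ _ eq)) (strictlyInverseʳ j))

    complete′ : (T : EdgeSet (N G)) → IsSpanningTree G T → ∃ λ i → T ≐ tree (to i)
    complete′ T T-spanning with complete T T-spanning
    ... | i , T≐treeᵢ =
      from i , λ x y → trans (T≐treeᵢ x y) (cong (λ j → tree j x y) (sym (strictlyInverseˡ i)))

module QuasiTree (e m : ℕ) where

  G : Graph
  G = DoubleNested (1 ∷ 1 ∷ []) (suc e ∷ m ∷ [])

  -- a and b form U₁ and U₂, the w j form V₁ and the p l form V₂ (sum lays out |V₂| as m + 0).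
  data Vertex : Set where
    a b : Vertex
    w   : Fin (suc e) → Vertex
    p   : Fin (m + 0) → Vertex

  vertex : Fin (N G) → Vertex
  vertex zero          = a
  vertex (suc zero)    = b
  vertex (suc (suc z)) = [ w , p ]′ (splitAt (suc e) z)

  index : Vertex → Fin (N G)
  index a     = zero
  index b     = suc zero
  index (w j) = suc (suc (j ↑ˡ (m + 0)))
  index (p l) = suc (suc (suc e ↑ʳ l))

  vertex-index : ∀ u → vertex (index u) ≡ u
  vertex-index a     = refl
  vertex-index b     = refl
  vertex-index (w j) = cong [ w , p ]′ (splitAt-↑ˡ (suc e) j (m + 0))
  vertex-index (p l) = cong [ w , p ]′ (splitAt-↑ʳ (suc e) (m + 0) l)

  index-vertex : ∀ x → index (vertex x) ≡ x
  index-vertex zero          = refl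
  index-vertex (suc zero)    = refl
  index-vertex (suc (suc z)) =
    trans (index-join (splitAt (suc e) z)) (cong (λ t → suc (suc t)) (join-splitAt (suc e) (m + 0) z))
    where
      index-join : ∀ s → index ([ w , p ]′ s) ≡ suc (suc (join (suc e) (m + 0) s))
      index-join (inj₁ j) = refl
      index-join (inj₂ l) = refl

  index-injective : ∀ {u v} → index u ≡ index v → u ≡ v
  index-injective {u} {v} eq = trans (sym (vertex-index u)) (trans (cong vertex eq) (vertex-index v))

  vertex-injective : ∀ {x y} → vertex x ≡ vertex y → x ≡ y
  vertex-injective {x} {y} eq = trans (sym (index-vertex x)) (trans (cong index eq) (index-vertex y))

  isU : Vertex → Bool
  isU a = true
  isU b = true
  isU _ = false

  arc : Vertex → Vertex → Bool
  arc a (w _) = true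
  arc a (p _) = true
  arc b (w _) = true
  arc _ _     = false

  adjᵛ : Vertex → Vertex → Bool
  adjᵛ u v = arc u v ∨ arc v u

  inV : (z : Fin (suc e + (m + 0))) → (toℕ z <ᵇ suc e + (m + 0)) ≡ true
  inV z = <⇒<ᵇ≡true (toℕ<n z)

  blockOf-V₁ : (j : Fin (suc e)) → blockOf (suc e ∷ m ∷ []) (toℕ (j ↑ˡ (m + 0))) ≡ 0
  blockOf-V₁ j rewrite toℕ-↑ˡ j (m + 0) | <⇒<ᵇ≡true (toℕ<n j) = refl

  blockOf-V₂ : (l : Fin (m + 0)) → blockOf (suc e ∷ m ∷ []) (toℕ (suc e ↑ʳ l)) ≡ 1
  blockOf-V₂ l rewrite toℕ-↑ʳ e l | m+n<ᵇm≡false e (toℕ l) | m+n∸m≡n e (toℕ l)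
                     | <⇒<ᵇ≡true (subst (toℕ l <_) (+-identityʳ m) (toℕ<n l)) = refl

  dnUV-index : ∀ u v →
               dnUV (1 ∷ 1 ∷ []) (suc e ∷ m ∷ []) (toℕ (index u)) (toℕ (index v)) ≡ arc u v
  dnUV-index a     a     = refl
  dnUV-index a     b     = refl
  dnUV-index a     (w j) = cong₂ _∧_ (inV (j ↑ˡ (m + 0))) (cong (_<ᵇ 2) (blockOf-V₁ j))
  dnUV-index a     (p l) = cong₂ _∧_ (inV (suc e ↑ʳ l)) (cong (_<ᵇ 2) (blockOf-V₂ l))
  dnUV-index b     a     = refl
  dnUV-index b     b     = refl
  dnUV-index b     (w j) = cong₂ _∧_ (inV (j ↑ˡ (m + 0))) (cong (λ i → 1 + i <ᵇ 2) (blockOf-V₁ j))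
  dnUV-index b     (p l) = cong₂ _∧_ (inV (suc e ↑ʳ l)) (cong (λ i → 1 + i <ᵇ 2) (blockOf-V₂ l))
  dnUV-index (w j) v     = refl
  dnUV-index (p l) v     = refl

  adj-index : ∀ u v → adj G (index u) (index v) ≡ adjᵛ u v
  adj-index u v = cong₂ _∨_ (dnUV-index u v) (dnUV-index v u)

  pull : EdgeSet (N G) → Vertex → Vertex → Bool
  pull S u v = S (index u) (index v)

  pull-vertex : ∀ S x y → S x y ≡ pull S (vertex x) (vertex y)
  pull-vertex S x y = sym (cong₂ S (index-vertex x) (index-vertex y))

  adj-vertex : ∀ x y → adj G x y ≡ adjᵛ (vertex x) (vertex y)
  adj-vertex x y = trans (pull-vertex (adj G) x y) (adj-index (vertex x) (vertex y))

  arc-bipartite : ∀ u v → arc u v ≡ true → isU u ≢ isU v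
  arc-bipartite a     (w _) _ = λ ()
  arc-bipartite a     (p _) _ = λ ()
  arc-bipartite b     (w _) _ = λ ()

  adjᵛ-bipartite : ∀ u v → adjᵛ u v ≡ true → isU u ≢ isU v
  adjᵛ-bipartite u v uv with ∨≡true uv
  ... | inj₁ arc-uv = arc-bipartite u v arc-uv
  ... | inj₂ arc-vu = arc-bipartite v u arc-vu ∘ sym

  isU≡true : ∀ u → isU u ≡ true → u ≡ a ⊎ u ≡ b
  isU≡true a _ = inj₁ refl
  isU≡true b _ = inj₂ refl

  joinedToA : Fin 2 → Bool
  joinedToA zero    = true
  joinedToA (suc _) = false

  label : Bool → Fin 2
  label true  = zero
  label false = suc zero

  joinedToA-label : ∀ x → joinedToA (label x) ≡ x
  joinedToA-label true  = refl
  joinedToA-label false = refl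

  -- The spanning tree with hub w h: w h is joined to both a and b, and w (punchIn h i)
  -- to a if s i = zero, to b otherwise.
  module _ (h : Fin (suc e)) (s : Fin e → Fin 2) where

    attachedToA : Fin (suc e) → Bool
    attachedToA j with h ≟ j
    ... | yes _   = true
    ... | no h≢j  = joinedToA (s (punchOut h≢j))

    attachedToB : Fin (suc e) → Bool
    attachedToB j with h ≟ j
    ... | yes _   = true
    ... | no h≢j  = not (joinedToA (s (punchOut h≢j)))

    link : Vertex → Vertex → Bool
    link a (w j) = attachedToA j
    link b (w j) = attachedToB j
    link a (p _) = true
    link _ _     = false

    treeᵛ : Vertex → Vertex → Bool
    treeᵛ u v = link u v ∨ link v u

    tree : EdgeSet (N G)
    tree x y = treeᵛ (vertex x) (vertex y)

    attachedToA-hub : attachedToA h ≡ true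
    attachedToA-hub with h ≟ h
    ... | yes _  = refl
    ... | no h≢h = ⊥-elim (h≢h refl)

    attachedToB-hub : attachedToB h ≡ true
    attachedToB-hub with h ≟ h
    ... | yes _  = refl
    ... | no h≢h = ⊥-elim (h≢h refl)

    attachedToB-¬A : ∀ j → attachedToA j ≡ false → attachedToB j ≡ true
    attachedToB-¬A j ¬A with h ≟ j
    ... | yes _ = ⊥-elim (true≢false ¬A)
    ... | no _  = cong not ¬A

    attachedToAB⇒hub : ∀ j → attachedToA j ≡ true → attachedToB j ≡ true → j ≡ h
    attachedToAB⇒hub j A B with h ≟ j
    ... | yes h≡j = sym h≡j
    ... | no _    = ⊥-elim (true≢false (trans (sym B) (cong not A)))

    attachedToA-punchIn : ∀ i → attachedToA (punchIn h i) ≡ joinedToA (s i)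
    attachedToA-punchIn i with h ≟ punchIn h i
    ... | yes h≡hᵢ = ⊥-elim (punchInᵢ≢i h i (sym h≡hᵢ))
    ... | no h≢hᵢ  = cong (joinedToA ∘ s) (trans (punchOut-cong′ h refl) (punchOut-punchIn h))

    link⊆arc : ∀ u v → link u v ≡ true → arc u v ≡ true
    link⊆arc a     (w _) _ = refl
    link⊆arc a     (p _) _ = refl
    link⊆arc b     (w _) _ = refl

    treeᵛ⊆adjᵛ : ∀ u v → treeᵛ u v ≡ true → adjᵛ u v ≡ true
    treeᵛ⊆adjᵛ u v = ∨-mono-≡true (link⊆arc u v) (link⊆arc v u)

    neighbour-p : ∀ {l} u → link u (p l) ≡ true → u ≡ a
    neighbour-p a     _ = refl

    neighbour-w : ∀ {j} u → link u (w j) ≡ true →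
                  (u ≡ a × attachedToA j ≡ true) ⊎ (u ≡ b × attachedToB j ≡ true)
    neighbour-w a     A = inj₁ (refl , A)
    neighbour-w b     B = inj₂ (refl , B)

    branching⇒hub : ∀ u → isU u ≡ false → ∀ v₁ v₂ → v₁ ≢ v₂ →
                    treeᵛ u v₁ ≡ true → treeᵛ u v₂ ≡ true → u ≡ w h
    branching⇒hub (p _) _ v₁ v₂ v₁≢v₂ t₁ t₂ =
      ⊥-elim (v₁≢v₂ (trans (neighbour-p v₁ t₁) (sym (neighbour-p v₂ t₂))))
    branching⇒hub (w j) _ v₁ v₂ v₁≢v₂ t₁ t₂ with neighbour-w v₁ t₁ | neighbour-w v₂ t₂
    ... | inj₁ (refl , _) | inj₁ (refl , _) = ⊥-elim (v₁≢v₂ refl)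
    ... | inj₂ (refl , _) | inj₂ (refl , _) = ⊥-elim (v₁≢v₂ refl)
    ... | inj₁ (refl , A) | inj₂ (refl , B) = cong w (attachedToAB⇒hub j A B)
    ... | inj₂ (refl , B) | inj₁ (refl , A) = cong w (attachedToAB⇒hub j A B)

    edge : ∀ u v → treeᵛ u v ≡ true → tree (index u) (index v) ≡ true
    edge u v = subst₂ (λ u′ v′ → treeᵛ u′ v′ ≡ true) (sym (vertex-index u)) (sym (vertex-index v))

    walkToA : ∀ u → Walk tree (index u) (index a)
    walkToA a     = here
    walkToA b     = step {v = index (w h)} (edge b (w h) (cong (_∨ false) attachedToB-hub))
                      (step {v = index a} (edge (w h) a attachedToA-hub) here)
    walkToA (p l) = step {v = index a} (edge (p l) a refl) here
    walkToA (w j) with attachedToA j in A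
    ... | true  = step {v = index a} (edge (w j) a A) here
    ... | false = step {v = index b} (edge (w j) b (attachedToB-¬A j A)) (walkToA b)

    tree-symmetric : ∀ x y → tree x y ≡ tree y x
    tree-symmetric x y = ∨-comm (link (vertex x) (vertex y)) (link (vertex y) (vertex x))

    tree-spanning : IsSpanningTree G tree
    tree-spanning = record
      { subgraph  = λ x y t → trans (adj-vertex x y) (treeᵛ⊆adjᵛ (vertex x) (vertex y) t)
      ; symmetric = tree-symmetric
      ; connected = connected-viaRoot tree-symmetric (index a)
                      (λ x → subst (λ z → Walk tree z (index a)) (index-vertex x) (walkToA (vertex x)))
      ; acyclic   = acyclic-bipartite-singleHub tree-symmetric (isU ∘ vertex)
                      (λ x y → adjᵛ-bipartite (vertex x) (vertex y) ∘ treeᵛ⊆adjᵛ (vertex x) (vertex y))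
                      (index (w h)) singleHub
      }
      where
        singleHub : ∀ x → isU (vertex x) ≡ false → Branching {T = tree} x → x ≡ index (w h)
        singleHub x side (y₁ , y₂ , y₁≢y₂ , t₁ , t₂) =
          trans (sym (index-vertex x))
                (cong index (branching⇒hub (vertex x) side (vertex y₁) (vertex y₂)
                                           (y₁≢y₂ ∘ vertex-injective) t₁ t₂))

  module _ (T : EdgeSet (N G)) (T-spanning : IsSpanningTree G T) where
    open IsSpanningTree T-spanning

    Tᵛ : Vertex → Vertex → Bool
    Tᵛ = pull T

    Tᵛ-edge : ∀ {x y u v} → T x y ≡ true → vertex x ≡ u → vertex y ≡ v → Tᵛ u v ≡ true
    Tᵛ-edge {x} {y} t refl refl = trans (sym (pull-vertex T x y)) t

    Tᵛ-flip : ∀ u v → Tᵛ u v ≡ true → Tᵛ v u ≡ true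
    Tᵛ-flip u v t = trans (symmetric (index v) (index u)) t

    T⊆adjᵛ : ∀ {x y} → T x y ≡ true → adjᵛ (vertex x) (vertex y) ≡ true
    T⊆adjᵛ {x} {y} t = trans (sym (adj-vertex x y)) (subgraph x y t)

    nonadjacent : ∀ u v → adjᵛ u v ≡ false → Tᵛ u v ≡ false
    nonadjacent u v ¬adj with Tᵛ u v in t
    ... | false = refl
    ... | true  =
      ⊥-elim (true≢false (trans (sym (subgraph (index u) (index v) t)) (trans (adj-index u v) ¬adj)))

    firstStepᵛ : ∀ u v → u ≢ v → ∃ λ y → T (index u) y ≡ true × adjᵛ u (vertex y) ≡ true
    firstStepᵛ u v u≢v with firstStep (connected (index u) (index v)) (u≢v ∘ index-injective)
    ... | y , t = y , t , subst (λ u′ → adjᵛ u′ (vertex y) ≡ true) (vertex-index u) (T⊆adjᵛ t)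

    pendant : ∀ l → Tᵛ a (p l) ≡ true
    pendant l with firstStepᵛ (p l) a (λ ())
    ... | y , t , adj = Tᵛ-flip (p l) a (Tᵛ-edge t (vertex-index (p l)) (onlyNeighbour (vertex y) adj))
      where
        onlyNeighbour : ∀ u → adjᵛ (p l) u ≡ true → u ≡ a
        onlyNeighbour a     _ = refl

    attached : ∀ j → Tᵛ a (w j) ≡ true ⊎ Tᵛ b (w j) ≡ true
    attached j with firstStepᵛ (w j) a (λ ())
    ... | y , t , adj with vertex y in y≡ | adj
    ... | a | _ = inj₁ (Tᵛ-flip (w j) a (Tᵛ-edge t (vertex-index (w j)) y≡))
    ... | b | _ = inj₂ (Tᵛ-flip (w j) b (Tᵛ-edge t (vertex-index (w j)) y≡))

    Hub : Fin (suc e) → Set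
    Hub j = Tᵛ a (w j) ≡ true × Tᵛ b (w j) ≡ true

    T-swapsSide : ∀ {x y} → T x y ≡ true → isU (vertex y) ≡ not (isU (vertex x))
    T-swapsSide {x} {y} t = ¬-not (adjᵛ-bipartite (vertex x) (vertex y) (T⊆adjᵛ t) ∘ sym)

    -- Where a walk from U first reaches b, it comes from a through some w j.
    hub-onWalk : ∀ {x y} → Walk T x y → isU (vertex x) ≡ true → vertex y ≡ b →
                 vertex x ≡ b ⊎ ∃ Hub
    hub-onWalk here _ y≡b = inj₁ y≡b
    hub-onWalk (step t here) xU y≡b =
      ⊥-elim (true≢false (trans (sym (cong isU y≡b)) (trans (T-swapsSide t) (cong not xU))))
    hub-onWalk {x} (step {v = v} t (step t′ walk)) xU y≡b
      with hub-onWalk walk (trans (T-swapsSide t′) (cong not (trans (T-swapsSide t) (cong not xU)))) y≡b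
    ... | inj₂ hub = inj₂ hub
    ... | inj₁ v′≡b with isU≡true (vertex x) xU
    ...   | inj₂ x≡b = inj₁ x≡b
    ...   | inj₁ x≡a
      with vertex v in v≡ | subst (λ u → adjᵛ (vertex v) u ≡ true) v′≡b (T⊆adjᵛ t′)
    ...     | w j | _ = inj₂ (j , Tᵛ-edge t x≡a v≡ , Tᵛ-flip (w j) b (Tᵛ-edge t′ v≡ v′≡b))

    hub-exists : ∃ Hub
    hub-exists with hub-onWalk (connected (index a) (index b)) refl refl
    ... | inj₂ hub = hub

    hub-unique : ∀ {j j′} → Hub j → Hub j′ → j ≡ j′
    hub-unique {j} {j′} (aj , bj) (aj′ , bj′) with j ≟ j′
    ... | yes j≡j′ = j≡j′
    ... | no j≢j′  = ⊥-elim (acyclic square)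
      where
        corner : Fin 4 → Vertex
        corner zero                   = a
        corner (suc zero)             = w j
        corner (suc (suc zero))       = b
        corner (suc (suc (suc zero))) = w j′

        position : Vertex → Fin 4
        position a     = zero
        position b     = suc (suc zero)
        position (w k) with j ≟ k
        ... | yes _ = suc zero
        ... | no _  = suc (suc (suc zero))
        position (p _) = zero

        position-corner : ∀ i → position (corner i) ≡ i
        position-corner zero                   = refl
        position-corner (suc (suc zero))       = refl
        position-corner (suc zero) with j ≟ j
        ... | yes _  = refl
        ... | no j≢j = ⊥-elim (j≢j refl)
        position-corner (suc (suc (suc zero))) with j ≟ j′
        ... | yes j≡j′ = ⊥-elim (j≢j′ j≡j′)
        ... | no _     = refl

        square : Cycle T
        square = record
          { k       = 1
          ; c       = index ∘ corner
          ; inj     = λ i i′ eq → trans (sym (position-corner i))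
                                    (trans (cong position (index-injective eq)) (position-corner i′))
          ; consec  = λ { zero → aj ; (suc zero) → Tᵛ-flip b (w j) bj ; (suc (suc zero)) → bj′ }
          ; closing = Tᵛ-flip a (w j′) aj′
          }

    hub : Fin (suc e)
    hub = proj₁ hub-exists

    code : Fin (2 ^ e)
    code = funToFin (λ i → label (Tᵛ a (w (punchIn hub i))))

    Tᵛ-a-offHub : ∀ {j} (hub≢j : hub ≢ j) → Tᵛ a (w j) ≡ joinedToA (finToFun code (punchOut hub≢j))
    Tᵛ-a-offHub {j} hub≢j = begin
      Tᵛ a (w j)                                    ≡⟨ cong (Tᵛ a ∘ w) (sym (punchIn-punchOut hub≢j)) ⟩
      Tᵛ a (w (punchIn hub i))                      ≡⟨ sym (joinedToA-label _) ⟩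
      joinedToA (label (Tᵛ a (w (punchIn hub i))))  ≡⟨ cong joinedToA (sym (finToFun-funToFin _ i)) ⟩
      joinedToA (finToFun code i)                   ∎
      where
        open ≡-Reasoning
        i : Fin e
        i = punchOut hub≢j

    Tᵛ-b-offHub : ∀ {j} → hub ≢ j → Tᵛ b (w j) ≡ not (Tᵛ a (w j))
    Tᵛ-b-offHub {j} hub≢j with Tᵛ a (w j) in A | Tᵛ b (w j) in B | attached j
    ... | true  | true  | _       = ⊥-elim (hub≢j (hub-unique (proj₂ hub-exists) (A , B)))
    ... | true  | false | _       = refl
    ... | false | true  | _       = refl
    ... | false | false | inj₁ ()
    ... | false | false | inj₂ ()

    Tᵛ-a-w : ∀ j → Tᵛ a (w j) ≡ attachedToA hub (finToFun code) j
    Tᵛ-a-w j with hub ≟ j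
    ... | yes refl  = proj₁ (proj₂ hub-exists)
    ... | no hub≢j  = Tᵛ-a-offHub hub≢j

    Tᵛ-b-w : ∀ j → Tᵛ b (w j) ≡ attachedToB hub (finToFun code) j
    Tᵛ-b-w j with hub ≟ j
    ... | yes refl  = proj₂ (proj₂ hub-exists)
    ... | no hub≢j  = trans (Tᵛ-b-offHub hub≢j) (cong not (Tᵛ-a-offHub hub≢j))

    Tᵛ≡treeᵛ : ∀ u v → Tᵛ u v ≡ treeᵛ hub (finToFun code) u v
    Tᵛ≡treeᵛ a     (w j)  = trans (Tᵛ-a-w j) (sym (∨-identityʳ _))
    Tᵛ≡treeᵛ b     (w j)  = trans (Tᵛ-b-w j) (sym (∨-identityʳ _))
    Tᵛ≡treeᵛ a     (p l)  = pendant l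
    Tᵛ≡treeᵛ (w j) a      = trans (symmetric _ _) (Tᵛ-a-w j)
    Tᵛ≡treeᵛ (w j) b      = trans (symmetric _ _) (Tᵛ-b-w j)
    Tᵛ≡treeᵛ (p l) a      = trans (symmetric _ _) (pendant l)
    Tᵛ≡treeᵛ a     a      = nonadjacent a a refl
    Tᵛ≡treeᵛ a     b      = nonadjacent a b refl
    Tᵛ≡treeᵛ b     a      = nonadjacent b a refl
    Tᵛ≡treeᵛ b     b      = nonadjacent b b refl
    Tᵛ≡treeᵛ b     (p l)  = nonadjacent b (p l) refl
    Tᵛ≡treeᵛ (p l) b      = nonadjacent (p l) b refl
    Tᵛ≡treeᵛ (w j) (w j′) = nonadjacent (w j) (w j′) refl
    Tᵛ≡treeᵛ (w j) (p l)  = nonadjacent (w j) (p l) refl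
    Tᵛ≡treeᵛ (p l) (w j)  = nonadjacent (p l) (w j) refl
    Tᵛ≡treeᵛ (p l) (p l′) = nonadjacent (p l) (p l′) refl

    T≐tree : T ≐ tree hub (finToFun code)
    T≐tree x y = trans (pull-vertex T x y) (Tᵛ≡treeᵛ (vertex x) (vertex y))

  joinedToA-injective : ∀ {x y} → joinedToA x ≡ joinedToA y → x ≡ y
  joinedToA-injective {zero}     {zero}     _  = refl
  joinedToA-injective {suc zero} {suc zero} _  = refl

  treeᵛ-determined : ∀ {h h′ s s′} → tree h s ≐ tree h′ s′ →
                     ∀ u v → treeᵛ h s u v ≡ treeᵛ h′ s′ u v
  treeᵛ-determined {h} {h′} {s} {s′} same u v = begin
    treeᵛ h s u v                   ≡⟨ cong₂ (treeᵛ h s) (sym (vertex-index u)) (sym (vertex-index v)) ⟩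
    tree h s (index u) (index v)    ≡⟨ same (index u) (index v) ⟩
    tree h′ s′ (index u) (index v)  ≡⟨ cong₂ (treeᵛ h′ s′) (vertex-index u) (vertex-index v) ⟩
    treeᵛ h′ s′ u v                 ∎
    where open ≡-Reasoning

  hub-determined : ∀ {h h′ s s′} → tree h s ≐ tree h′ s′ → h ≡ h′
  hub-determined {h} {h′} {s} {s′} same =
    attachedToAB⇒hub h′ s′ h (trans (sym (treeᵛ-determined same (w h) a)) (attachedToA-hub h s))
                             (trans (sym (treeᵛ-determined same (w h) b)) (attachedToB-hub h s))

  labels-determined : ∀ {h s s′} → tree h s ≐ tree h s′ → ∀ i → s i ≡ s′ i
  labels-determined {h} {s} {s′} same i = joinedToA-injective (begin
    joinedToA (s i)                 ≡⟨ sym (attachedToA-punchIn h s i) ⟩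
    attachedToA h s (punchIn h i)   ≡⟨ treeᵛ-determined same (w (punchIn h i)) a ⟩
    attachedToA h s′ (punchIn h i)  ≡⟨ attachedToA-punchIn h s′ i ⟩
    joinedToA (s′ i)                ∎)
    where open ≡-Reasoning

  treeOf : Fin (2 ^ e) × Fin (suc e) → EdgeSet (N G)
  treeOf (q , h) = tree h (finToFun q)

  treeOf-injective : ∀ i j → treeOf i ≐ treeOf j → i ≡ j
  treeOf-injective (q , h) (q′ , h′) same with hub-determined same
  ... | refl = cong (_, h) (begin
    q                                  ≡⟨ sym (funToFin-finToFin {e} {2} q) ⟩
    funToFin (finToFun {2} {e} q)      ≡⟨ funToFin-cong (labels-determined same) ⟩
    funToFin (finToFun {2} {e} q′)     ≡⟨ funToFin-finToFin {e} {2} q′ ⟩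
    q′                                 ∎)
    where open ≡-Reasoning

  numSpanningTrees : NumSpanningTrees G (2 ^ e * suc e)
  numSpanningTrees =
    numSpanningTrees-byEnumeration (*↔× {2 ^ e} {suc e}) treeOf
      (λ (q , h) → tree-spanning h (finToFun q)) treeOf-injective
      (λ T T-spanning → (code T T-spanning , hub T T-spanning) , T≐tree T T-spanning)

-- The count holds for every d₀ ≥ 1 and every size of V₂.
theorem6 : (n d₀ : ℕ) → 2 ≤ d₀ → d₀ ≤ n ∸ 3 →
    NumSpanningTrees (DoubleNested (1 ∷ 1 ∷ []) (d₀ ∷ (n ∸ d₀ ∸ 2) ∷ []))
                     (2 ^ (d₀ ∸ 1) * d₀)
theorem6 n (suc (suc e)) (s≤s (s≤s _)) _ = QuasiTree.numSpanningTrees (suc e) (n ∸ suc (suc e) ∸ 2)
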